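{- Let $m\geq 2$ and let $L_{m\times n}$ be one of the following sets of binary $m\times n$ matrices (rows $A_1,\dots,A_m$ read as binary strings of length $n$): (Even case) $n\geq 4$ even, $u\in D_{n-2}$ fixed, $A_1:=1u0$, and $L_{m\times n}$ consists of the matrices whose first row is $A_1$, whose rows $A_i$ ($i\geq 2$) differ from $A_1$, whose rows $A_i$ ($2\leq i\leq m-1$) are each of one of the forms (type 1) a word in $D_n$, (type 2) $11w$, (type 3) $w00$, (type 4) $01w$ with $w\in D_{n-2}$, $w\neq u$ in types 2–4, or (type 5) $0w0$ with $w\in D_{n-2}$, and whose last row is of type 1, 2 or 3. (Odd case) $n\geq 5$ odd, $u\in D_{n-3}$ fixed, $A_1:=11u0$, and $L_{m\times n}$ consists of the matrices whose first row is $A_1$, whose rows $A_i$ ($i\geq 2$) differ from $A_1$, whose rows $A_i$ ($2\leq i\leq m-1$) are each of one of the forms (type 6) $1w$, (type 7) $w0$ with $w\in D_{n-1}$, $w\neq 1u0$, or (type 8) $0w$ with $w\in D_{n-1}$, and whose last row is of type 6 or 7. Suppose $X$ is a binary string of length $n$ such that: (1) in the even case, $X$ is not of type 1, 2, 3, 4 or 5 as just described; in the odd case, $X$ is not of the form $1w$, $w0$ or $0w$ for any $w\in D_{n-1}$; and (2) $X$ and $A_1$ are non-overlapping strings. Let $Z$ be the binary $m\times n$ matrix whose first row is $A_1$ and whose rows $2,\dots,m$ are all equal to $X$. Then $L_{m\times n}\cup\{Z\}$ is a non-overlapping set of matrices.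
   Context: For $\ell\geq 1$, a Dyck word of length $2\ell$ is a binary string $v$ of length $2\ell$ with equally many $1$'s and $0$'s such that every prefix of $v$ contains at least as many $1$'s as $0$'s; $D_{2\ell}$ denotes the set of Dyck words of length $2\ell$. Concatenation of strings is written by juxtaposition. Two strings $x,y$ are non-overlapping strings if no non-empty proper prefix of $x$ equals a non-empty proper suffix of $y$, and no non-empty proper prefix of $y$ equals a non-empty proper suffix of $x$. Two binary $m\times n$ matrices $A=(a_{i,j})$ and $B=(b_{i,j})$ overlap at shift $(p,q)\in\mathbb{Z}^2$ with $|p|\leq m-1$, $|q|\leq n-1$ if $a_{i,j}=b_{i+p,j+q}$ for all $(i,j)$ with $1\leq i,i+p\leq m$ and $1\leq j,j+q\leq n$. Two distinct matrices are non-overlapping if they overlap at no such shift; a matrix $A$ is self non-overlapping if $A$ and $A$ overlap at no such shift with $(p,q)\neq(0,0)$. A set of $m\times n$ matrices is non-overlapping if each of its matrices is self non-overlapping and any two distinct matrices in it are non-overlapping. -}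

module Defs where

open import Data.Bool using (Bool; true; false)
open import Data.Nat using (ℕ; zero; suc; _+_; _*_; _∸_; _≤_; _<_)
open import Data.Nat.Divisibility using (_∣_)
open import Data.Integer as ℤ using (ℤ; +_; ∣_∣)
open import Data.Fin using (Fin; toℕ)
open import Data.List using (List; []; _∷_; _++_; length; take; filterᵇ)
open import Data.Vec using (Vec; lookup; toList)
open import Data.Product using (Σ; ∃; ∃-syntax; _×_; _,_)
open import Data.Sum using (_⊎_)
open import Relation.Binary.PropositionalEquality using (_≡_; _≢_)
open import Relation.Nullary using (¬_)

-- Binary strings: lists of booleans, with 1 = true and 0 = false.
BStr : Set
BStr = List Bool

ones : BStr → ℕ
ones v = length (filterᵇ (λ b → b) v)

zeros : BStr → ℕ
zeros v = length (filterᵇ (λ { true → false ; false → true }) v)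

InD : ℕ → BStr → Set
InD k v = (∃[ ℓ ] (1 ≤ ℓ × k ≡ 2 * ℓ))
        × length v ≡ k
        × ones v ≡ zeros v
        × (∀ i → zeros (take i v) ≤ ones (take i v))

PrefixSuffixMatch : BStr → BStr → Set
PrefixSuffixMatch x y =
  ∃[ p ] ∃[ s ] ∃[ t ] (p ≢ [] × s ≢ [] × t ≢ [] × x ≡ p ++ s × y ≡ t ++ p)

NonOverlappingStrings : BStr → BStr → Set
NonOverlappingStrings x y = ¬ PrefixSuffixMatch x y × ¬ PrefixSuffixMatch y x

-- Binary m × n matrices (0-indexed rows/columns; shifts are differences, so
-- the indexing convention is immaterial).
Matrix : ℕ → ℕ → Set
Matrix m n = Vec (Vec Bool n) m

entry : ∀ {m n} → Matrix m n → Fin m → Fin n → Bool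
entry A i j = lookup (lookup A i) j

row : ∀ {m n} → Matrix m n → Fin m → BStr
row A i = toList (lookup A i)

fz : ∀ {k} → Fin k → ℤ
fz i = + (toℕ i)

OverlapAt : ∀ {m n} → Matrix m n → Matrix m n → ℤ → ℤ → Set
OverlapAt {m} {n} A B p q =
  ∀ (i i′ : Fin m) (j j′ : Fin n) →
    fz i′ ≡ fz i ℤ.+ p → fz j′ ≡ fz j ℤ.+ q → entry A i j ≡ entry B i′ j′

Shift : ℕ → ℕ → ℤ → ℤ → Set
Shift m n p q = ∣ p ∣ < m × ∣ q ∣ < n

NonOverlapping : ∀ {m n} → Matrix m n → Matrix m n → Set
NonOverlapping {m} {n} A B = ∀ p q → Shift m n p q → ¬ OverlapAt A B p q

SelfNonOverlapping : ∀ {m n} → Matrix m n → Set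
SelfNonOverlapping {m} {n} A =
  ∀ p q → Shift m n p q → ¬ (p ≡ + 0 × q ≡ + 0) → ¬ OverlapAt A A p q

NonOverlappingSet : ∀ {m n} → (Matrix m n → Set) → Set
NonOverlappingSet {m} {n} S =
  (∀ A → S A → SelfNonOverlapping A)
  × (∀ A B → S A → S B → A ≢ B → NonOverlapping A B)

IsFirst IsMiddle IsLast : ∀ {m} → Fin m → Set
IsFirst i = toℕ i ≡ 0
IsMiddle {m} i = 1 ≤ toℕ i × suc (toℕ i) < m
IsLast {m} i = suc (toℕ i) ≡ m

A1e : BStr → BStr
A1e u = true ∷ u ++ false ∷ []

Type1 Type5 : ℕ → BStr → Set
Type1 n r = InD n r
Type5 n r = ∃[ w ] (InD (n ∸ 2) w × r ≡ false ∷ w ++ false ∷ [])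

Type2 Type3 Type4 : ℕ → BStr → BStr → Set
Type2 n u r = ∃[ w ] (InD (n ∸ 2) w × w ≢ u × r ≡ true ∷ true ∷ w)
Type3 n u r = ∃[ w ] (InD (n ∸ 2) w × w ≢ u × r ≡ w ++ false ∷ false ∷ [])
Type4 n u r = ∃[ w ] (InD (n ∸ 2) w × w ≢ u × r ≡ false ∷ true ∷ w)

MiddleEven LastEven : ℕ → BStr → BStr → Set
MiddleEven n u r = Type1 n r ⊎ Type2 n u r ⊎ Type3 n u r ⊎ Type4 n u r ⊎ Type5 n r
LastEven n u r = Type1 n r ⊎ Type2 n u r ⊎ Type3 n u r

InLeven : ∀ {m n} → BStr → Matrix m n → Set
InLeven {m} {n} u M = ∀ (i : Fin m) →
    (IsFirst i → row M i ≡ A1e u)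
  × (¬ IsFirst i → row M i ≢ A1e u)
  × (IsMiddle i → MiddleEven n u (row M i))
  × (IsLast i → LastEven n u (row M i))

A1o : BStr → BStr
A1o u = true ∷ true ∷ u ++ false ∷ []

Type6 Type7 : ℕ → BStr → BStr → Set
Type6 n u r = ∃[ w ] (InD (n ∸ 1) w × w ≢ A1e u × r ≡ true ∷ w)
Type7 n u r = ∃[ w ] (InD (n ∸ 1) w × w ≢ A1e u × r ≡ w ++ false ∷ [])

Type8 : ℕ → BStr → Set
Type8 n r = ∃[ w ] (InD (n ∸ 1) w × r ≡ false ∷ w)

MiddleOdd LastOdd : ℕ → BStr → BStr → Set
MiddleOdd n u r = Type6 n u r ⊎ Type7 n u r ⊎ Type8 n r
LastOdd n u r = Type6 n u r ⊎ Type7 n u r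

InLodd : ∀ {m n} → BStr → Matrix m n → Set
InLodd {m} {n} u M = ∀ (i : Fin m) →
    (IsFirst i → row M i ≡ A1o u)
  × (¬ IsFirst i → row M i ≢ A1o u)
  × (IsMiddle i → MiddleOdd n u (row M i))
  × (IsLast i → LastOdd n u (row M i))

OddForm : ℕ → BStr → Set
OddForm n r = ∃[ w ] (InD (n ∸ 1) w
  × (r ≡ true ∷ w ⊎ r ≡ w ++ false ∷ [] ⊎ r ≡ false ∷ w))

IsZ : ∀ {m n} → BStr → Vec Bool n → Matrix m n → Set
IsZ {m} A1 X Z = ∀ (i : Fin m) →
  (IsFirst i → row Z i ≡ A1) × (¬ IsFirst i → lookup Z i ≡ X)

module Submission where

-- Write A₁ for the common first row.  All matrices under
-- consideration have first row A₁ and all other rows different from A₁,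
-- so an overlap at vertical shift 0 makes A₁ overlap itself, while an
-- overlap at a non-zero vertical shift puts the A₁ of one matrix against
-- a non-first row R of the other.  Everything therefore reduces to the
-- string facts that A₁ is self non-overlapping, that no proper prefix of A₁
-- is a suffix of R, and that a proper prefix of R can be a suffix of A₁
-- only when it has length 1.  In that last case the two matrices are
-- shifted by n−1 columns and a final 0 of a row of one matrix faces the
-- initial 1 of the last row of the other, which is again a contradiction.
-- The string facts are proved by counting: the rows are built from Dyck
-- words, whose prefixes are 1-heavy and whose suffixes are 0-heavy, and the
-- only rows escaping this count are one shift away from A₁, which the
-- conditions w ≠ u (resp. w ≠ 1u0) exclude.

open import Defs
open import Data.Bool using (Bool; true; false)
open import Data.Nat using (ℕ; zero; suc; _+_; _∸_; _≤_; _<_; z≤n; s≤s; _⊓_; _<?_; _≟_)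
open import Data.Nat.Divisibility using (_∣_)
open import Data.Nat.Properties
open import Data.Integer as ℤ using (ℤ; +_; -[1+_]; ∣_∣)
import Data.Integer.Properties as ℤP
open import Data.Fin using (Fin; zero; suc; toℕ; fromℕ<; fromℕ)
open import Data.Fin.Properties using (toℕ-fromℕ<; toℕ-fromℕ; toℕ<n)
open import Data.Vec using (Vec; []; _∷_; lookup; toList)
open import Data.Vec.Properties using (length-toList; tabulate∘lookup; tabulate-cong)
open import Data.List using (List; []; _∷_; _++_; length; take; drop)
open import Data.List.Properties
  using (length-++; ++-assoc; ++-identityʳ; take++drop≡id; length-take; length-drop;
         ∷-injectiveˡ; ∷-injectiveʳ; ∷ʳ-injectiveˡ)
open import Data.Product using (∃-syntax; _×_; _,_; proj₁; proj₂)
open import Data.Sum using (_⊎_; inj₁; inj₂)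
open import Data.Empty using (⊥; ⊥-elim)
open import Relation.Nullary using (¬_; yes; no)
open import Relation.Binary.PropositionalEquality

[0] : BStr
[0] = false ∷ []

-- `xs ! j` is the j-th bit of xs (counted from 0), and 0 past the end.
_!_ : BStr → ℕ → Bool
[] ! _ = false
(x ∷ xs) ! zero = x
(x ∷ xs) ! suc j = xs ! j

!-ext : ∀ (xs ys : BStr) → length xs ≡ length ys →
        (∀ j → j < length xs → xs ! j ≡ ys ! j) → xs ≡ ys
!-ext [] [] _ _ = refl
!-ext (x ∷ xs) (y ∷ ys) eq f =
  cong₂ _∷_ (f 0 (s≤s z≤n)) (!-ext xs ys (suc-injective eq) (λ j j< → f (suc j) (s≤s j<)))

take-! : ∀ k (xs : BStr) j → j < k → take k xs ! j ≡ xs ! j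
take-! (suc k) [] j _ = refl
take-! (suc k) (x ∷ xs) zero _ = refl
take-! (suc k) (x ∷ xs) (suc j) (s≤s j<) = take-! k xs j j<

drop-! : ∀ d (xs : BStr) j → drop d xs ! j ≡ xs ! (d + j)
drop-! zero xs j = refl
drop-! (suc d) [] j = refl
drop-! (suc d) (x ∷ xs) j = drop-! d xs j

last-! : ∀ (xs : BStr) b → (xs ++ b ∷ []) ! length xs ≡ b
last-! [] b = refl
last-! (x ∷ xs) b = last-! xs b

lookup-! : ∀ {n} (v : Vec Bool n) (j : Fin n) → lookup v j ≡ toList v ! toℕ j
lookup-! (x ∷ v) zero = refl
lookup-! (x ∷ v) (suc j) = lookup-! v j

ones-++ : ∀ xs ys → ones (xs ++ ys) ≡ ones xs + ones ys
ones-++ [] ys = refl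
ones-++ (true ∷ xs) ys = cong suc (ones-++ xs ys)
ones-++ (false ∷ xs) ys = ones-++ xs ys

zeros-++ : ∀ xs ys → zeros (xs ++ ys) ≡ zeros xs + zeros ys
zeros-++ [] ys = refl
zeros-++ (true ∷ xs) ys = zeros-++ xs ys
zeros-++ (false ∷ xs) ys = cong suc (zeros-++ xs ys)

ones-snoc0 : ∀ xs → ones (xs ++ [0]) ≡ ones xs
ones-snoc0 xs = trans (ones-++ xs [0]) (+-identityʳ (ones xs))

zeros-snoc0 : ∀ xs → zeros (xs ++ [0]) ≡ suc (zeros xs)
zeros-snoc0 xs = trans (zeros-++ xs [0]) (+-comm (zeros xs) 1)

snoc-split : ∀ (xs : BStr) z P S → xs ++ z ∷ [] ≡ P ++ S →
  (S ≡ [] × P ≡ xs ++ z ∷ []) ⊎ (∃[ S' ] (S ≡ S' ++ z ∷ [] × xs ≡ P ++ S'))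
snoc-split xs z [] S eq = inj₂ (xs , sym eq , refl)
snoc-split [] z (y ∷ []) [] eq = inj₁ (refl , sym eq)
snoc-split [] z (y ∷ []) (s ∷ S) ()
snoc-split [] z (y ∷ y' ∷ P) S ()
snoc-split (x ∷ xs) z (y ∷ P) S eq with snoc-split xs z P S (∷-injectiveʳ eq)
... | inj₁ (S≡ , P≡) = inj₁ (S≡ , cong₂ _∷_ (sym (∷-injectiveˡ eq)) P≡)
... | inj₂ (S' , S≡ , xs≡) = inj₂ (S' , S≡ , cong₂ _∷_ (∷-injectiveˡ eq) xs≡)

prefix-of-same-length : ∀ {a : BStr} p s → a ≡ p ++ s → length a ≡ length p → a ≡ p
prefix-of-same-length p s refl eq = trans (cong (p ++_) (s≡[] p s eq)) (++-identityʳ p)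
  where
  s≡[] : ∀ (p s : BStr) → length (p ++ s) ≡ length p → s ≡ []
  s≡[] [] [] _ = refl
  s≡[] (_ ∷ p) s eq = s≡[] p s (suc-injective eq)

suffix-of-same-length : ∀ {a : BStr} t p → a ≡ t ++ p → length a ≡ length p → t ≡ []
suffix-of-same-length [] p _ _ = refl
suffix-of-same-length (x ∷ t) p refl eq =
  ⊥-elim (m≢1+n+m (length p) (sym (trans (cong suc (sym (length-++ t))) eq)))

∷≢[] : ∀ {x : Bool} {xs : BStr} → x ∷ xs ≢ []
∷≢[] ()

snoc≢[] : ∀ (xs : BStr) b → xs ++ b ∷ [] ≢ []
snoc≢[] [] b ()
snoc≢[] (x ∷ xs) b ()

unsnoc : ∀ (xs : BStr) → xs ≢ [] → ∃[ ys ] ∃[ b ] (xs ≡ ys ++ b ∷ [])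
unsnoc [] ne = ⊥-elim (ne refl)
unsnoc (x ∷ []) ne = [] , x , refl
unsnoc (x ∷ y ∷ xs) ne with unsnoc (y ∷ xs) (λ ())
... | ys , b , eq = x ∷ ys , b , cong (x ∷_) eq

StartsWith1 EndsWith0 : BStr → Set
StartsWith1 r = ∃[ r' ] r ≡ true ∷ r'
EndsWith0 r = ∃[ r' ] r ≡ r' ++ [0]

PrefixCond SuffixCond : BStr → Set
PrefixCond v = ∀ p s → v ≡ p ++ s → zeros p ≤ ones p
SuffixCond v = ∀ t s → v ≡ t ++ s → ones s ≤ zeros s

Dyck⇒PrefixCond : ∀ {k v} → InD k v → PrefixCond v
Dyck⇒PrefixCond (_ , _ , _ , pre) p s refl =
  subst (λ z → zeros z ≤ ones z) (take-++-length p s) (pre (length p))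
  where
  take-++-length : ∀ (p s : BStr) → take (length p) (p ++ s) ≡ p
  take-++-length [] s = refl
  take-++-length (x ∷ p) s = cong (x ∷_) (take-++-length p s)

PrefixCond⇒prefixes : ∀ {v} → PrefixCond v → ∀ i → zeros (take i v) ≤ ones (take i v)
PrefixCond⇒prefixes {v} pc i = pc (take i v) (drop i v) (sym (take++drop≡id i v))

balanced-SuffixCond : ∀ v → ones v ≡ zeros v → PrefixCond v → SuffixCond v
balanced-SuffixCond v bal pc t s refl =
  +-cancelˡ-≤ (zeros t) _ _ (begin
    zeros t + ones s ≤⟨ +-monoˡ-≤ (ones s) (pc t s refl) ⟩
    ones t + ones s  ≡⟨ ones-++ t s ⟨
    ones (t ++ s)    ≡⟨ bal ⟩
    zeros (t ++ s)   ≡⟨ zeros-++ t s ⟩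
    zeros t + zeros s ∎)
  where open ≤-Reasoning

Dyck⇒SuffixCond : ∀ {k v} → InD k v → SuffixCond v
Dyck⇒SuffixCond {v = v} d@(_ , _ , bal , _) = balanced-SuffixCond v bal (Dyck⇒PrefixCond d)

Dyck-length : ∀ {k v} → InD k v → length v ≡ k
Dyck-length (_ , len , _) = len

Dyck≢[] : ∀ {k v} → InD k v → v ≢ []
Dyck≢[] ((suc ℓ , _ , k≡) , len , _) refl with trans len k≡
... | ()

Dyck-starts-with-1 : ∀ {k v} → InD k v → StartsWith1 v
Dyck-starts-with-1 {v = []} d = ⊥-elim (Dyck≢[] d refl)
Dyck-starts-with-1 {v = true ∷ v'} d = v' , refl
Dyck-starts-with-1 {v = false ∷ v'} d with Dyck⇒PrefixCond d (false ∷ []) v' refl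
... | ()

Dyck-ends-with-0 : ∀ {k v} → InD k v → EndsWith0 v
Dyck-ends-with-0 {v = v} d@(_ , _ , bal , _) with unsnoc v (Dyck≢[] d)
... | ys , false , eq = ys , eq
... | ys , true , refl = ⊥-elim (<⇒≱ zeros>ones (Dyck⇒PrefixCond d ys (true ∷ []) refl))
  where
  zeros>ones : ones ys < zeros ys
  zeros>ones = begin-strict
    ones ys                     <⟨ m<m+n (ones ys) (s≤s z≤n) ⟩
    ones ys + 1                 ≡⟨ ones-++ ys (true ∷ []) ⟨
    ones (ys ++ true ∷ [])      ≡⟨ bal ⟩
    zeros (ys ++ true ∷ [])     ≡⟨ trans (zeros-++ ys (true ∷ [])) (+-identityʳ (zeros ys)) ⟩
    zeros ys                    ∎
    where open ≤-Reasoning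

PrefixCond-cons1 : ∀ w → PrefixCond w → PrefixCond (true ∷ w)
PrefixCond-cons1 w pc [] s eq = z≤n
PrefixCond-cons1 w pc (x ∷ p) s eq with ∷-injectiveˡ eq
... | refl = m≤n⇒m≤1+n (pc p s (∷-injectiveʳ eq))

wrap-Dyck : ∀ {k u} → InD k u → InD (2 + k) (A1e u)
wrap-Dyck {k} {u} d@((ℓ , 1≤ℓ , k≡) , len , bal , _) =
  (suc ℓ , s≤s z≤n , trans (cong (λ x → 2 + x) k≡) (sym (*-suc 2 ℓ)))
  , cong suc (trans (length-++ u) (trans (+-comm (length u) 1) (cong suc len)))
  , balanced
  , PrefixCond⇒prefixes wrap-PrefixCond
  where
  balanced : ones (A1e u) ≡ zeros (A1e u)
  balanced = trans (cong suc (trans (ones-snoc0 u) bal)) (sym (zeros-snoc0 u))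
  wrap-PrefixCond : PrefixCond (A1e u)
  wrap-PrefixCond p s eq with snoc-split (true ∷ u) false p s eq
  ... | inj₁ (_ , refl) = ≤-reflexive (sym balanced)
  ... | inj₂ (s' , _ , u≡) = PrefixCond-cons1 u (Dyck⇒PrefixCond d) p s' u≡

Prefix< Suffix< : BStr → Set
Prefix< v = ∀ p s → v ≡ p ++ s → p ≢ [] → zeros p < ones p
Suffix< v = ∀ t s → v ≡ t ++ s → s ≢ [] → ones s < zeros s

ProperPrefix≤ ProperPrefix< ProperSuffix≤ ProperSuffix< : BStr → Set
ProperPrefix≤ v = ∀ p s → v ≡ p ++ s → s ≢ [] → zeros p ≤ ones p
ProperPrefix< v = ∀ p s → v ≡ p ++ s → p ≢ [] → s ≢ [] → zeros p < ones p
ProperSuffix≤ v = ∀ t s → v ≡ t ++ s → t ≢ [] → ones s ≤ zeros s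
ProperSuffix< v = ∀ t s → v ≡ t ++ s → t ≢ [] → s ≢ [] → ones s < zeros s

PrefixCond⇒ProperPrefix≤ : ∀ {v} → PrefixCond v → ProperPrefix≤ v
PrefixCond⇒ProperPrefix≤ pc p s eq _ = pc p s eq

Prefix<⇒ProperPrefix< : ∀ {v} → Prefix< v → ProperPrefix< v
Prefix<⇒ProperPrefix< pc p s eq p≢[] _ = pc p s eq p≢[]

SuffixCond⇒ProperSuffix≤ : ∀ {v} → SuffixCond v → ProperSuffix≤ v
SuffixCond⇒ProperSuffix≤ sc t s eq _ = sc t s eq

Suffix<⇒ProperSuffix< : ∀ {v} → Suffix< v → ProperSuffix< v
Suffix<⇒ProperSuffix< sc t s eq _ s≢[] = sc t s eq s≢[]

Prefix<-cons1 : ∀ w → PrefixCond w → Prefix< (true ∷ w)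
Prefix<-cons1 w pc [] s eq p≢[] = ⊥-elim (p≢[] refl)
Prefix<-cons1 w pc (x ∷ p) s eq _ with ∷-injectiveˡ eq
... | refl = s≤s (pc p s (∷-injectiveʳ eq))

Suffix<-snoc0 : ∀ w → SuffixCond w → Suffix< (w ++ [0])
Suffix<-snoc0 w sc t s eq s≢[] with snoc-split w false t s eq
... | inj₁ (s≡[] , _) = ⊥-elim (s≢[] s≡[])
... | inj₂ (s' , refl , w≡) =
  subst₂ _<_ (sym (ones-snoc0 s')) (sym (zeros-snoc0 s')) (s≤s (sc t s' w≡))

SuffixCond-snoc0 : ∀ w → SuffixCond w → SuffixCond (w ++ [0])
SuffixCond-snoc0 w sc t [] eq = z≤n
SuffixCond-snoc0 w sc t (x ∷ s) eq = <⇒≤ (Suffix<-snoc0 w sc t (x ∷ s) eq (λ ()))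

-- Proper prefixes of w ++ [x] are prefixes of w.
ProperPrefix≤-snoc : ∀ w x → PrefixCond w → ProperPrefix≤ (w ++ x ∷ [])
ProperPrefix≤-snoc w x pc p s eq s≢[] with snoc-split w x p s eq
... | inj₁ (s≡[] , _) = ⊥-elim (s≢[] s≡[])
... | inj₂ (s' , _ , w≡) = pc p s' w≡

ProperPrefix<-snoc : ∀ w x → Prefix< w → ProperPrefix< (w ++ x ∷ [])
ProperPrefix<-snoc w x pc p s eq p≢[] s≢[] with snoc-split w x p s eq
... | inj₁ (s≡[] , _) = ⊥-elim (s≢[] s≡[])
... | inj₂ (s' , _ , w≡) = pc p s' w≡ p≢[]

-- Proper suffixes of x ∷ w are suffixes of w.
ProperSuffix≤-cons : ∀ x w → SuffixCond w → ProperSuffix≤ (x ∷ w)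
ProperSuffix≤-cons x w sc [] s eq t≢[] = ⊥-elim (t≢[] refl)
ProperSuffix≤-cons x w sc (y ∷ t) s eq _ = sc t s (∷-injectiveʳ eq)

ProperSuffix<-cons : ∀ x w → Suffix< w → ProperSuffix< (x ∷ w)
ProperSuffix<-cons x w sc [] s eq t≢[] _ = ⊥-elim (t≢[] refl)
ProperSuffix<-cons x w sc (y ∷ t) s eq _ s≢[] = sc t s (∷-injectiveʳ eq) s≢[]

ZeroSuffix< : BStr → Set
ZeroSuffix< y = ∀ t p → y ≡ t ++ false ∷ p → p ≢ [] → ones p < zeros p

-- A suffix following a 0 is a proper suffix.
ProperSuffix<⇒ZeroSuffix< : ∀ {y} → ProperSuffix< y → ZeroSuffix< y
ProperSuffix<⇒ZeroSuffix< sc t p eq p≢[] =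
  sc (t ++ [0]) p (trans eq (sym (++-assoc t [0] p))) (snoc≢[] t false) p≢[]

-- A leading 1 cannot follow a 0, so it does not affect ZeroSuffix<.
ZeroSuffix<-cons1 : ∀ y → ZeroSuffix< y → ZeroSuffix< (true ∷ y)
ZeroSuffix<-cons1 y zs [] p () _
ZeroSuffix<-cons1 y zs (x ∷ t) p eq p≢[] = zs t p (∷-injectiveʳ eq) p≢[]

-- The strict condition implies the weak one (the empty suffix is balanced).
ProperSuffix<⇒ProperSuffix≤ : ∀ {v} → ProperSuffix< v → ProperSuffix≤ v
ProperSuffix<⇒ProperSuffix≤ sc t [] eq t≢[] = z≤n
ProperSuffix<⇒ProperSuffix≤ sc t (x ∷ s) eq t≢[] = <⇒≤ (sc t (x ∷ s) eq t≢[] ∷≢[])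

wrap-ProperPrefix< : ∀ u → PrefixCond u → ProperPrefix< (A1e u)
wrap-ProperPrefix< u pc = ProperPrefix<-snoc (true ∷ u) false (Prefix<-cons1 u pc)

wrap-ProperSuffix< : ∀ u → SuffixCond u → ProperSuffix< (A1e u)
wrap-ProperSuffix< u sc = ProperSuffix<-cons true (u ++ [0]) (Suffix<-snoc0 u sc)

-- `MatchOf x y p`: p is a non-empty proper prefix of x and a non-empty
-- proper suffix of y; `PrefixSuffixMatch x y` is exactly `∃ (MatchOf x y)`.
MatchOf : BStr → BStr → BStr → Set
MatchOf x y p = ∃[ s ] ∃[ t ] (p ≢ [] × s ≢ [] × t ≢ [] × x ≡ p ++ s × y ≡ t ++ p)

no-match-1heavy : ∀ {x y} → ProperPrefix< x → ProperSuffix≤ y → ¬ PrefixSuffixMatch x y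
no-match-1heavy pre suf (p , s , t , p≢[] , s≢[] , t≢[] , x≡ , y≡) =
  <⇒≱ (pre p s x≡ p≢[] s≢[]) (suf t p y≡ t≢[])

no-match-0heavy : ∀ {x y} → ProperPrefix≤ x → ProperSuffix< y → ¬ PrefixSuffixMatch x y
no-match-0heavy pre suf (p , s , t , p≢[] , s≢[] , t≢[] , x≡ , y≡) =
  <⇒≱ (suf t p y≡ t≢[] p≢[]) (pre p s x≡ s≢[])

-- a ++ [c] against x ∷ w with |w| = |a|: the only match that escapes the
-- counting obstruction is the longest one, p = w = a.
cons-snoc-no-match : ∀ x c (a w : BStr) → length w ≡ length a → w ≢ a →
  ProperPrefix< a → ProperSuffix≤ w → ¬ PrefixSuffixMatch (a ++ c ∷ []) (x ∷ w)
cons-snoc-no-match x c a w len w≢a pre suf (p , s , [] , _ , _ , t≢[] , _) = t≢[] refl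
cons-snoc-no-match x c a w len w≢a pre suf (p , s , _ ∷ t , p≢[] , s≢[] , _ , e1 , e2)
  with snoc-split a c p s e1
... | inj₁ (s≡[] , _) = s≢[] s≡[]
... | inj₂ (s' , _ , a≡) = split t s' (∷-injectiveʳ e2) a≡
  where
  split : ∀ t s' → w ≡ t ++ p → a ≡ p ++ s' → ⊥
  -- p = w forces a = w
  split [] s' refl a≡ = w≢a (sym (prefix-of-same-length p s' a≡ (sym len)))
  -- p = a would be a proper suffix of w of the same length
  split (y ∷ t) [] w≡ a≡ =
    ∷≢[] (suffix-of-same-length (y ∷ t) p w≡ (trans len (cong length (trans a≡ (++-identityʳ p)))))
  -- p is a proper part of both: the counting obstruction
  split (y ∷ t) (z ∷ s') w≡ a≡ = <⇒≱ (pre p (z ∷ s') a≡ p≢[] (λ ())) (suf (y ∷ t) p w≡ (λ ()))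

snoc-cons-no-match : ∀ c x (w a : BStr) → length w ≡ length a → w ≢ a →
  ProperPrefix≤ w → ProperSuffix< a → ¬ PrefixSuffixMatch (w ++ c ∷ []) (x ∷ a)
snoc-cons-no-match c x w a len w≢a pre suf (p , s , [] , _ , _ , t≢[] , _) = t≢[] refl
snoc-cons-no-match c x w a len w≢a pre suf (p , s , _ ∷ t , p≢[] , s≢[] , _ , e1 , e2)
  with snoc-split w c p s e1
... | inj₁ (s≡[] , _) = s≢[] s≡[]
... | inj₂ (s' , _ , w≡) = split t s' (∷-injectiveʳ e2) w≡
  where
  split : ∀ t s' → a ≡ t ++ p → w ≡ p ++ s' → ⊥
  -- p = a forces w = a
  split [] s' refl w≡ = w≢a (prefix-of-same-length p s' w≡ len)
  -- p = w would be a proper suffix of a of the same length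
  split (y ∷ t) [] a≡ w≡ =
    ∷≢[] (suffix-of-same-length (y ∷ t) p a≡ (trans (sym len) (cong length (trans w≡ (++-identityʳ p)))))
  -- p is a proper part of both: the counting obstruction
  split (y ∷ t) (z ∷ s') a≡ w≡ = <⇒≱ (suf (y ∷ t) p a≡ (λ ()) p≢[]) (pre p (z ∷ s') w≡ (λ ()))

zero-row-match : ∀ v y → ProperPrefix≤ v → ZeroSuffix< y →
  ∀ p → MatchOf (false ∷ v) y p → length p ≡ 1
zero-row-match v y pre zs [] (_ , _ , p≢[] , _) = ⊥-elim (p≢[] refl)
zero-row-match v y pre zs (_ ∷ []) _ = refl
zero-row-match v y pre zs (b ∷ b' ∷ p) (s , t , _ , s≢[] , _ , e1 , e2) with ∷-injectiveˡ e1
... | refl = ⊥-elim (<⇒≱ (zs t (b' ∷ p) e2 (λ ())) (pre (b' ∷ p) s (∷-injectiveʳ e1) s≢[]))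

matrix-ext : ∀ {m n} (A B : Matrix m n) → (∀ i j → entry A i j ≡ entry B i j) → A ≡ B
matrix-ext A B eq = trans (sym (tabulate∘lookup A)) (trans (tabulate-cong row-eq) (tabulate∘lookup B))
  where
  row-eq : ∀ i → lookup A i ≡ lookup B i
  row-eq i = trans (sym (tabulate∘lookup (lookup A i)))
               (trans (tabulate-cong (eq i)) (tabulate∘lookup (lookup B i)))

overlap-bits : ∀ {m n} (A B : Matrix m n) p q → OverlapAt A B p q →
  ∀ i i' → fz i' ≡ fz i ℤ.+ p →
  ∀ {j j'} (j< : j < n) (j'< : j' < n) → + j' ≡ + j ℤ.+ q → row A i ! j ≡ row B i' ! j'
overlap-bits A B p q ov i i' ei {j} {j'} j< j'< ej = begin
  row A i ! j                     ≡⟨ cong (row A i !_) (toℕ-fromℕ< j<) ⟨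
  row A i ! toℕ (fromℕ< j<)       ≡⟨ lookup-! (lookup A i) (fromℕ< j<) ⟨
  entry A i (fromℕ< j<)           ≡⟨ ov i i' (fromℕ< j<) (fromℕ< j'<) ei ej' ⟩
  entry B i' (fromℕ< j'<)         ≡⟨ lookup-! (lookup B i') (fromℕ< j'<) ⟩
  row B i' ! toℕ (fromℕ< j'<)     ≡⟨ cong (row B i' !_) (toℕ-fromℕ< j'<) ⟩
  row B i' ! j'                   ∎
  where
  open ≡-Reasoning
  ej' : fz (fromℕ< j'<) ≡ fz (fromℕ< j<) ℤ.+ q
  ej' = subst₂ (λ a b → + a ≡ + b ℤ.+ q) (sym (toℕ-fromℕ< j'<)) (sym (toℕ-fromℕ< j<)) ej

-- Row a placed d columns to the left of row b agrees with it where both exist.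
RowShift : ℕ → BStr → BStr → ℕ → Set
RowShift n a b d = ∀ j → j + d < n → a ! j ≡ b ! (j + d)

-- A horizontal shift q = d ≥ 0 (resp. q = −(e+1)) aligns the rows of A
-- (resp. of B) d (resp. e+1) columns to the left of those of the other matrix.
row-shift⁺ : ∀ {m n} (A B : Matrix m n) p d → OverlapAt A B p (+ d) →
  ∀ i i' → fz i' ≡ fz i ℤ.+ p → RowShift n (row A i) (row B i') d
row-shift⁺ A B p d ov i i' ei j jd = overlap-bits A B p (+ d) ov i i' ei (≤-<-trans (m≤m+n j d) jd) jd refl

row-shift⁻ : ∀ {m n} (A B : Matrix m n) p e → OverlapAt A B p -[1+ e ] →
  ∀ i i' → fz i' ≡ fz i ℤ.+ p → RowShift n (row B i') (row A i) (suc e)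
row-shift⁻ A B p e ov i i' ei j jd =
  sym (overlap-bits A B p -[1+ e ] ov i i' ei jd (≤-<-trans (m≤m+n j (suc e)) jd)
    (sym (trans (ℤP.⊖-≥ (m≤n+m (suc e) j)) (cong +_ (m+n∸n≡m j (suc e))))))

shift-match : ∀ n a b d → length a ≡ n → length b ≡ n → 0 < d → d < n →
  RowShift n a b d → ∃[ p ] (MatchOf a b p × length p ≡ n ∸ d)
shift-match n a b d la lb 0<d d<n shift =
  p , (s , t , nonempty p (≤-trans (m<n⇒0<n∸m d<n) (≤-reflexive (sym lp)))
             , nonempty s (≤-trans 0<d (≤-reflexive (sym ls)))
             , nonempty t (≤-trans 0<d (≤-reflexive (sym lt)))
             , sym (take++drop≡id (n ∸ d) a)
             , trans (sym (take++drop≡id d b)) (cong (t ++_) drop≡p)) , lp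
  where
  p s t : BStr
  p = take (n ∸ d) a
  s = drop (n ∸ d) a
  t = take d b
  d≤n : d ≤ n
  d≤n = <⇒≤ d<n
  nonempty : ∀ (xs : BStr) → 1 ≤ length xs → xs ≢ []
  nonempty (x ∷ xs) _ ()
  lp : length p ≡ n ∸ d
  lp = trans (length-take (n ∸ d) a) (trans (cong ((n ∸ d) ⊓_) la) (m≤n⇒m⊓n≡m (m∸n≤m n d)))
  ls : length s ≡ d
  ls = trans (length-drop (n ∸ d) a) (trans (cong (_∸ (n ∸ d)) la) (m∸[m∸n]≡n d≤n))
  lt : length t ≡ d
  lt = trans (length-take d b) (trans (cong (d ⊓_) lb) (m≤n⇒m⊓n≡m d≤n))
  ld : length (drop d b) ≡ n ∸ d
  ld = trans (length-drop d b) (cong (_∸ d) lb)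
  drop≡p : drop d b ≡ p
  drop≡p = !-ext (drop d b) p (trans ld (sym lp)) λ j j< →
    let j<n∸d : j < n ∸ d
        j<n∸d = subst (j <_) ld j<
        jd : j + d < n
        jd = subst (j + d <_) (m∸n+n≡m d≤n) (+-monoˡ-< d j<n∸d)
    in trans (drop-! d b j) (trans (cong (b !_) (+-comm d j))
         (trans (sym (shift j jd)) (sym (take-! (n ∸ d) a j j<n∸d))))

shift-equal : ∀ n a b → length a ≡ n → length b ≡ n → RowShift n a b 0 → a ≡ b
shift-equal n a b la lb shift = !-ext a b (trans la (sym lb)) λ j j< →
  trans (shift j (subst (_< n) (sym (+-identityʳ j)) (subst (j <_) la j<)))
        (cong (b !_) (+-identityʳ j))

overlap-flip : ∀ {m n} (A B : Matrix m n) p q → OverlapAt A B p q → OverlapAt B A (ℤ.- p) (ℤ.- q)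
overlap-flip A B p q ov i i' j j' ei ej = sym (ov i' i j' j (move p ei) (move q ej))
  where
  move : ∀ {x y : ℤ} r → x ≡ y ℤ.+ ℤ.- r → y ≡ x ℤ.+ r
  move {x} {y} r eq = sym (begin
    x ℤ.+ r               ≡⟨ cong (ℤ._+ r) eq ⟩
    y ℤ.+ ℤ.- r ℤ.+ r     ≡⟨ ℤP.+-assoc y (ℤ.- r) r ⟩
    y ℤ.+ (ℤ.- r ℤ.+ r)   ≡⟨ cong (λ z → y ℤ.+ z) (ℤP.+-inverseˡ r) ⟩
    y ℤ.+ + 0             ≡⟨ ℤP.+-identityʳ y ⟩
    y                     ∎)
    where open ≡-Reasoning

record RowConditions {m n : ℕ} (S : Matrix m n → Set) (A₁ : BStr) : Set where
  field
    first-row       : ∀ M → S M → ∀ i → IsFirst i → row M i ≡ A₁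
    A₁-self         : ¬ PrefixSuffixMatch A₁ A₁
    other-row≢A₁    : ∀ M → S M → ∀ i → ¬ IsFirst i → row M i ≢ A₁
    A₁-then-row     : ∀ M → S M → ∀ i → ¬ IsFirst i → ¬ PrefixSuffixMatch A₁ (row M i)
    row-then-A₁     : ∀ M → S M → ∀ i → ¬ IsFirst i → ∀ p → MatchOf (row M i) A₁ p →
                      length p ≡ 1 × (∀ k → IsLast k → StartsWith1 (row M k))
    rows-end-with-0 : ∀ M → S M → ∀ i → EndsWith0 (row M i)

module Criterion {m' n : ℕ} {S : Matrix (suc m') n → Set} {A₁ : BStr} (C : RowConditions S A₁) where
  open RowConditions C

  row-length : ∀ (M : Matrix (suc m') n) i → length (row M i) ≡ n
  row-length M i = length-toList (lookup M i)

  -- At vertical shift 0 the first rows overlap, so a non-zero horizontal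
  -- shift would make A₁ overlap itself.
  first-rows-shift : ∀ A B → S A → S B → ∀ d → 0 < d → d < n →
                     ¬ RowShift n (row A zero) (row B zero) d
  first-rows-shift A B sA sB d 0<d d<n shift
    with shift-match n _ _ d (row-length A zero) (row-length B zero) 0<d d<n shift
  ... | p , match , _ =
    A₁-self (subst₂ PrefixSuffixMatch (first-row A sA zero refl) (first-row B sB zero refl) (p , match))

  -- Vertical shift d+1 and horizontal shift −(n−1): the final 0 of row
  -- m'−(d+1) of A lies on the first bit of the last row of B.
  corner-clash : ∀ A B → S A → ∀ d → suc d < suc m' → ∀ e → n ≡ suc (suc e) →
                 OverlapAt A B (+ suc d) -[1+ e ] → ¬ StartsWith1 (row B (fromℕ m'))
  corner-clash A B sA d d< e n≡ ov (r , rB) = false≢true false≡true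
    where
    false≢true : false ≢ true
    false≢true ()
    iA : Fin (suc m')
    iA = fromℕ< {m' ∸ suc d} (s≤s (m∸n≤m m' (suc d)))
    r' : BStr
    r' = proj₁ (rows-end-with-0 A sA iA)
    rA : row A iA ≡ r' ++ [0]
    rA = proj₂ (rows-end-with-0 A sA iA)
    aligned : fz (fromℕ m') ≡ fz iA ℤ.+ + suc d
    aligned = cong +_ (trans (toℕ-fromℕ m')
                (sym (trans (cong (_+ suc d) (toℕ-fromℕ< (s≤s (m∸n≤m m' (suc d)))))
                            (m∸n+n≡m (≤-pred d<)))))
    r'-length : length r' ≡ suc e
    r'-length = suc-injective (begin
      suc (length r')      ≡⟨ +-comm 1 (length r') ⟩
      length r' + 1        ≡⟨ length-++ r' ⟨
      length (r' ++ [0])   ≡⟨ cong length rA ⟨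
      length (row A iA)    ≡⟨ row-length A iA ⟩
      n                    ≡⟨ n≡ ⟩
      suc (suc e)          ∎)
      where open ≡-Reasoning
    false≡true : false ≡ true
    false≡true = begin
      false                    ≡⟨ last-! r' false ⟨
      (r' ++ [0]) ! length r'  ≡⟨ cong₂ _!_ (sym rA) r'-length ⟩
      row A iA ! suc e         ≡⟨ overlap-bits A B (+ suc d) -[1+ e ] ov iA (fromℕ m') aligned
                                    (subst (suc e <_) (sym n≡) ≤-refl) (subst (0 <_) (sym n≡) (s≤s z≤n))
                                    (sym (ℤP.n⊖n≡0 (suc e))) ⟩
      row B (fromℕ m') ! 0     ≡⟨ cong (_! 0) rB ⟩
      true                     ∎
      where open ≡-Reasoning

  -- At vertical shift d+1 the first row A₁ of A faces the row i = d+1 of B.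
  module Facing (A B : Matrix (suc m') n) (sA : S A) (sB : S B) (d : ℕ) (d< : suc d < suc m') where
    i : Fin (suc m')
    i = fromℕ< d<
    aligned : fz i ≡ fz {suc m'} zero ℤ.+ + suc d
    aligned = cong +_ (toℕ-fromℕ< d<)
    not-first : ¬ IsFirst i
    not-first eq with trans (sym (toℕ-fromℕ< d<)) eq
    ... | ()
    A₁≡ : row A zero ≡ A₁
    A₁≡ = first-row A sA zero refl

    -- without horizontal shift, row i of B would be A₁
    unshifted : ¬ OverlapAt A B (+ suc d) (+ 0)
    unshifted ov = other-row≢A₁ B sB i not-first (sym (trans (sym A₁≡) rows-equal))
      where
      rows-equal : row A zero ≡ row B i
      rows-equal = shift-equal n _ _ (row-length A zero) (row-length B i)
                     (row-shift⁺ A B (+ suc d) 0 ov zero i aligned)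

    -- shifted right, a proper prefix of A₁ would be a suffix of row i of B
    shifted-right : ∀ e → suc e < n → ¬ OverlapAt A B (+ suc d) (+ suc e)
    shifted-right e e< ov
      with shift-match n _ _ (suc e) (row-length A zero) (row-length B i) (s≤s z≤n) e<
             (row-shift⁺ A B (+ suc d) (suc e) ov zero i aligned)
    ... | p , match , _ =
      A₁-then-row B sB i not-first (subst (λ x → PrefixSuffixMatch x (row B i)) A₁≡ (p , match))

    -- shifted left, a proper prefix of row i of B is a suffix of A₁; it has
    -- length 1, so the shift is −(n−1) and the corner clash applies
    shifted-left : ∀ e → suc e < n → ¬ OverlapAt A B (+ suc d) -[1+ e ]
    shifted-left e e< ov
      with shift-match n _ _ (suc e) (row-length B i) (row-length A zero) (s≤s z≤n) e<
             (row-shift⁻ A B (+ suc d) e ov zero i aligned)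
    ... | p , match , p-length
      with row-then-A₁ B sB i not-first p (subst (λ y → MatchOf (row B i) y p) A₁≡ match)
    ... | length≡1 , last-rows =
      corner-clash A B sA d d< e n≡ ov (last-rows (fromℕ m') (cong suc (toℕ-fromℕ m')))
      where
      n≡ : n ≡ suc (suc e)
      n≡ = sym (trans (cong (_+ suc e) (trans (sym length≡1) p-length)) (m∸n+n≡m (<⇒≤ e<)))

  -- A positive vertical shift is impossible (a negative one becomes positive
  -- after swapping A and B).
  downward-shift : ∀ A B → S A → S B → ∀ d → suc d < suc m' → ∀ q → ∣ q ∣ < n →
                   ¬ OverlapAt A B (+ suc d) q
  downward-shift A B sA sB d d< (+ zero) _ = Facing.unshifted A B sA sB d d<
  downward-shift A B sA sB d d< (+ suc e) e< = Facing.shifted-right A B sA sB d d< e e<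
  downward-shift A B sA sB d d< -[1+ e ] e< = Facing.shifted-left A B sA sB d d< e e<

  overlap-is-trivial : ∀ A B → S A → S B → ∀ p q → Shift (suc m') n p q →
                       OverlapAt A B p q → p ≡ + 0 × q ≡ + 0 × A ≡ B
  overlap-is-trivial A B sA sB (+ zero) (+ zero) _ ov =
    refl , refl , matrix-ext A B (λ i j → ov i i j j (sym (ℤP.+-identityʳ _)) (sym (ℤP.+-identityʳ _)))
  overlap-is-trivial A B sA sB (+ zero) (+ suc e) (_ , e<) ov =
    ⊥-elim (first-rows-shift A B sA sB (suc e) (s≤s z≤n) e< (row-shift⁺ A B (+ 0) (suc e) ov zero zero refl))
  overlap-is-trivial A B sA sB (+ zero) -[1+ e ] (_ , e<) ov =
    ⊥-elim (first-rows-shift B A sB sA (suc e) (s≤s z≤n) e< (row-shift⁻ A B (+ 0) e ov zero zero refl))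
  overlap-is-trivial A B sA sB (+ suc d) q (d< , q<) ov =
    ⊥-elim (downward-shift A B sA sB d d< q q< ov)
  overlap-is-trivial A B sA sB -[1+ d ] q (d< , q<) ov =
    ⊥-elim (downward-shift B A sB sA d d< (ℤ.- q) (subst (_< n) (sym (ℤP.∣-i∣≡∣i∣ q)) q<)
             (overlap-flip A B -[1+ d ] q ov))

  non-overlapping : NonOverlappingSet S
  non-overlapping =
    (λ A sA p q sh nontrivial ov →
       let p≡0 , q≡0 , _ = overlap-is-trivial A A sA sA p q sh ov in nontrivial (p≡0 , q≡0)) ,
    (λ A B sA sB A≢B p q sh ov → A≢B (proj₂ (proj₂ (overlap-is-trivial A B sA sB p q sh ov))))

-- Membership in a family L given by its first row A₁, its admissible middle
-- rows Mid and its admissible last rows Last; InLeven and InLodd are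
-- instances of it.
InL : ∀ {m n} → (BStr → Set) → (BStr → Set) → BStr → Matrix m n → Set
InL {m} Mid Last A₁ M = ∀ (i : Fin m) →
    (IsFirst i → row M i ≡ A₁)
  × (¬ IsFirst i → row M i ≢ A₁)
  × (IsMiddle i → Mid (row M i))
  × (IsLast i → Last (row M i))

record RowTypes (Mid Last : BStr → Set) (A₁ : BStr) : Set where
  field
    last⇒mid           : ∀ R → Last R → Mid R
    A₁-self            : ¬ PrefixSuffixMatch A₁ A₁
    A₁-ends-with-0     : EndsWith0 A₁
    A₁-then-mid        : ∀ R → Mid R → ¬ PrefixSuffixMatch A₁ R
    mid-then-A₁        : ∀ R → Mid R → ∀ p → MatchOf R A₁ p → length p ≡ 1
    mid-ends-with-0    : ∀ R → Mid R → EndsWith0 R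
    last-starts-with-1 : ∀ R → Last R → StartsWith1 R

L∪Z-non-overlapping :
  ∀ {m' n} {Mid Last : BStr → Set} {A₁ : BStr} → RowTypes Mid Last A₁ →
  (X : Vec Bool n) (Z : Matrix (suc m') n) →
  toList X ≢ A₁ → NonOverlappingStrings (toList X) A₁ → EndsWith0 (toList X) → IsZ A₁ X Z →
  NonOverlappingSet (λ M → InL Mid Last A₁ M ⊎ M ≡ Z)
L∪Z-non-overlapping {m'} {n} {Mid} {Last} {A₁} T X Z X≢A₁ (X-then-A₁ , A₁-then-X) X-ends-with-0 isZ =
  Criterion.non-overlapping conditions
  where
  open RowTypes T
  S : Matrix (suc m') n → Set
  S M = InL Mid Last A₁ M ⊎ M ≡ Z

  later-row-mid : ∀ M → InL Mid Last A₁ M → ∀ i → ¬ IsFirst i → Mid (row M i)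
  later-row-mid M L i not-first with suc (toℕ i) <? suc m'
  ... | yes below = proj₁ (proj₂ (proj₂ (L i))) (n≢0⇒n>0 not-first , below)
  ... | no not-below =
    last⇒mid _ (proj₂ (proj₂ (proj₂ (L i))) (≤-antisym (toℕ<n i) (≮⇒≥ not-below)))

  Z-row : ∀ i → ¬ IsFirst i → row Z i ≡ toList X
  Z-row i not-first = cong toList (proj₂ (isZ i) not-first)

  first-row : ∀ M → S M → ∀ i → IsFirst i → row M i ≡ A₁
  first-row M (inj₁ L) i first = proj₁ (L i) first
  first-row M (inj₂ refl) i first = proj₁ (isZ i) first

  rows-end-with-0 : ∀ M → S M → ∀ i → EndsWith0 (row M i)
  rows-end-with-0 M sM i with toℕ i ≟ 0
  ... | yes first = subst EndsWith0 (sym (first-row M sM i first)) A₁-ends-with-0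
  rows-end-with-0 M (inj₁ L) i | no not-first = mid-ends-with-0 _ (later-row-mid M L i not-first)
  rows-end-with-0 M (inj₂ refl) i | no not-first = subst EndsWith0 (sym (Z-row i not-first)) X-ends-with-0

  conditions : RowConditions S A₁
  conditions = record
    { first-row = first-row
    ; A₁-self = A₁-self
    ; other-row≢A₁ = λ
        { M (inj₁ L) i not-first → proj₁ (proj₂ (L i)) not-first
        ; M (inj₂ refl) i not-first eq → X≢A₁ (trans (sym (Z-row i not-first)) eq) }
    ; A₁-then-row = λ
        { M (inj₁ L) i not-first → A₁-then-mid _ (later-row-mid M L i not-first)
        ; M (inj₂ refl) i not-first →
            subst (λ R → ¬ PrefixSuffixMatch A₁ R) (sym (Z-row i not-first)) A₁-then-X }
    ; row-then-A₁ = λ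
        { M (inj₁ L) i not-first p match →
            mid-then-A₁ _ (later-row-mid M L i not-first) p match ,
            λ k last → last-starts-with-1 _ (proj₂ (proj₂ (proj₂ (L k))) last)
        ; M (inj₂ refl) i not-first p match →
            ⊥-elim (X-then-A₁ (p , subst (λ R → MatchOf R A₁ p) (Z-row i not-first) match)) }
    ; rows-end-with-0 = rows-end-with-0
    }

-- A string of length ≥ 2 ending in 1 has the prefix 1 of 1a as a suffix.
ends-with-0-or-match : ∀ a x → a ≢ [] → 2 ≤ length x →
  ¬ PrefixSuffixMatch (true ∷ a) x → EndsWith0 x
ends-with-0-or-match a [] a≢[] () no-match
ends-with-0-or-match a (b ∷ x) a≢[] 2≤ no-match with unsnoc (b ∷ x) ∷≢[]
... | ys , false , eq = ys , eq
... | [] , true , refl with 2≤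
...   | s≤s ()
ends-with-0-or-match a (b ∷ x) a≢[] 2≤ no-match | y ∷ ys , true , eq =
  ⊥-elim (no-match (true ∷ [] , a , y ∷ ys , ∷≢[] , a≢[] , ∷≢[] , refl , eq))

pattern type₁ d = inj₁ d
pattern type₂ x = inj₂ (inj₁ x)
pattern type₃ x = inj₂ (inj₂ (inj₁ x))
pattern type₄ x = inj₂ (inj₂ (inj₂ (inj₁ x)))
pattern type₅ x = inj₂ (inj₂ (inj₂ (inj₂ x)))
pattern last₁ d = inj₁ d
pattern last₂ x = inj₂ (inj₁ x)
pattern last₃ x = inj₂ (inj₂ x)

snoc-length : ∀ (w u : BStr) x → length w ≡ length u → length (w ++ x ∷ []) ≡ length (u ++ x ∷ [])
snoc-length w u x eq = trans (length-++ w) (trans (cong (_+ 1) eq) (sym (length-++ u)))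

even-row-types : ∀ n' u → InD n' u →
  RowTypes (MiddleEven (2 + n') u) (LastEven (2 + n') u) (A1e u)
even-row-types n' u du = record
  { last⇒mid = last⇒mid
  ; A₁-self = no-match-1heavy A₁-prefix< (ProperSuffix<⇒ProperSuffix≤ A₁-suffix<)
  ; A₁-ends-with-0 = true ∷ u , refl
  ; A₁-then-mid = A₁-then-mid
  ; mid-then-A₁ = mid-then-A₁
  ; mid-ends-with-0 = mid-ends-with-0
  ; last-starts-with-1 = last-starts-with-1
  }
  where
  n : ℕ
  n = 2 + n'
  pcU : PrefixCond u
  pcU = Dyck⇒PrefixCond du
  scU : SuffixCond u
  scU = Dyck⇒SuffixCond du
  A₁-prefix< : ProperPrefix< (A1e u)
  A₁-prefix< = wrap-ProperPrefix< u pcU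
  A₁-suffix< : ProperSuffix< (A1e u)
  A₁-suffix< = wrap-ProperSuffix< u scU

  last⇒mid : ∀ R → LastEven n u R → MiddleEven n u R
  last⇒mid R (last₁ d) = type₁ d
  last⇒mid R (last₂ x) = type₂ x
  last⇒mid R (last₃ x) = type₃ x

  -- types 2 and 4, x1w, are one shift away from A₁ = 1u0
  x1w-after-A₁ : ∀ x w → InD n' w → w ≢ u → ¬ PrefixSuffixMatch (A1e u) (x ∷ true ∷ w)
  x1w-after-A₁ x w dw w≢u =
    cons-snoc-no-match x false (true ∷ u) (true ∷ w)
      (cong suc (trans (Dyck-length dw) (sym (Dyck-length du)))) (λ eq → w≢u (∷-injectiveʳ eq))
      (Prefix<⇒ProperPrefix< (Prefix<-cons1 u pcU)) (ProperSuffix≤-cons true w (Dyck⇒SuffixCond dw))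

  A₁-then-mid : ∀ R → MiddleEven n u R → ¬ PrefixSuffixMatch (A1e u) R
  A₁-then-mid R (type₁ dR) =
    no-match-1heavy A₁-prefix< (SuffixCond⇒ProperSuffix≤ (Dyck⇒SuffixCond dR))
  A₁-then-mid _ (type₂ (w , dw , w≢u , refl)) = x1w-after-A₁ true w dw w≢u
  A₁-then-mid _ (type₃ (w , dw , _ , refl)) =
    no-match-1heavy A₁-prefix< (SuffixCond⇒ProperSuffix≤
      (subst SuffixCond (++-assoc w [0] [0])
        (SuffixCond-snoc0 (w ++ [0]) (SuffixCond-snoc0 w (Dyck⇒SuffixCond dw)))))
  A₁-then-mid _ (type₄ (w , dw , w≢u , refl)) = x1w-after-A₁ false w dw w≢u
  A₁-then-mid _ (type₅ (w , dw , refl)) =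
    no-match-1heavy A₁-prefix<
      (ProperSuffix≤-cons false (w ++ [0]) (SuffixCond-snoc0 w (Dyck⇒SuffixCond dw)))

  mid-then-A₁ : ∀ R → MiddleEven n u R → ∀ p → MatchOf R (A1e u) p → length p ≡ 1
  mid-then-A₁ R (type₁ dR) p match =
    ⊥-elim (no-match-0heavy (PrefixCond⇒ProperPrefix≤ (Dyck⇒PrefixCond dR)) A₁-suffix< (p , match))
  mid-then-A₁ _ (type₂ (w , dw , _ , refl)) p match =
    ⊥-elim (no-match-0heavy
      (PrefixCond⇒ProperPrefix≤ (PrefixCond-cons1 _ (PrefixCond-cons1 w (Dyck⇒PrefixCond dw))))
      A₁-suffix< (p , match))
  -- type 3, w00, is one shift away from A₁ = 1u0
  mid-then-A₁ _ (type₃ (w , dw , w≢u , refl)) p match =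
    ⊥-elim (snoc-cons-no-match false true (w ++ [0]) (u ++ [0])
      (snoc-length w u false (trans (Dyck-length dw) (sym (Dyck-length du))))
      (λ eq → w≢u (∷ʳ-injectiveˡ w u eq))
      (ProperPrefix≤-snoc w false (Dyck⇒PrefixCond dw)) (Suffix<⇒ProperSuffix< (Suffix<-snoc0 u scU))
      (p , subst (λ R → MatchOf R (A1e u) p) (sym (++-assoc w [0] [0])) match))
  mid-then-A₁ _ (type₄ (w , dw , _ , refl)) =
    zero-row-match (true ∷ w) (A1e u)
      (PrefixCond⇒ProperPrefix≤ (PrefixCond-cons1 w (Dyck⇒PrefixCond dw)))
      (ProperSuffix<⇒ZeroSuffix< A₁-suffix<)
  mid-then-A₁ _ (type₅ (w , dw , refl)) =
    zero-row-match (w ++ [0]) (A1e u)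
      (ProperPrefix≤-snoc w false (Dyck⇒PrefixCond dw)) (ProperSuffix<⇒ZeroSuffix< A₁-suffix<)

  mid-ends-with-0 : ∀ R → MiddleEven n u R → EndsWith0 R
  mid-ends-with-0 R (type₁ dR) = Dyck-ends-with-0 dR
  mid-ends-with-0 _ (type₂ (w , dw , _ , refl)) with Dyck-ends-with-0 dw
  ... | w' , refl = true ∷ true ∷ w' , refl
  mid-ends-with-0 _ (type₃ (w , _ , _ , refl)) = w ++ [0] , sym (++-assoc w [0] [0])
  mid-ends-with-0 _ (type₄ (w , dw , _ , refl)) with Dyck-ends-with-0 dw
  ... | w' , refl = false ∷ true ∷ w' , refl
  mid-ends-with-0 _ (type₅ (w , _ , refl)) = false ∷ w , refl

  last-starts-with-1 : ∀ R → LastEven n u R → StartsWith1 R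
  last-starts-with-1 R (last₁ dR) = Dyck-starts-with-1 dR
  last-starts-with-1 _ (last₂ (w , _ , _ , refl)) = true ∷ w , refl
  last-starts-with-1 _ (last₃ (w , dw , _ , refl)) with Dyck-starts-with-1 dw
  ... | w' , refl = w' ++ false ∷ false ∷ [] , refl

pattern type₆ x = inj₁ x
pattern type₇ x = inj₂ (inj₁ x)
pattern type₈ x = inj₂ (inj₂ x)
pattern last₆ x = inj₁ x
pattern last₇ x = inj₂ x

-- Odd case, A₁ = 11u0 with u ∈ D_{n−3}: the rows of types 6–8 have the
-- properties required by L∪Z-non-overlapping.  Note A₁ = 1v0 for v = 1u.
odd-row-types : ∀ n' u → InD n' u →
  RowTypes (MiddleOdd (3 + n') u) (LastOdd (3 + n') u) (A1o u)
odd-row-types n' u du = record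
  { last⇒mid = last⇒mid
  ; A₁-self = no-match-1heavy A₁-prefix< A₁-suffix≤
  ; A₁-ends-with-0 = true ∷ true ∷ u , refl
  ; A₁-then-mid = A₁-then-mid
  ; mid-then-A₁ = mid-then-A₁
  ; mid-ends-with-0 = mid-ends-with-0
  ; last-starts-with-1 = last-starts-with-1
  }
  where
  n : ℕ
  n = 3 + n'
  pcU : PrefixCond u
  pcU = Dyck⇒PrefixCond du
  scU : SuffixCond u
  scU = Dyck⇒SuffixCond du
  A₁-prefix< : ProperPrefix< (A1o u)
  A₁-prefix< = wrap-ProperPrefix< (true ∷ u) (PrefixCond-cons1 u pcU)
  -- A₁ = 1 (1u0) with 1u0 a Dyck word
  A₁-suffix≤ : ProperSuffix≤ (A1o u)
  A₁-suffix≤ = ProperSuffix≤-cons true (A1e u) (Dyck⇒SuffixCond (wrap-Dyck du))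
  A₁-zero-suffix< : ZeroSuffix< (A1o u)
  A₁-zero-suffix< = ZeroSuffix<-cons1 (A1e u) (ProperSuffix<⇒ZeroSuffix< (wrap-ProperSuffix< u scU))

  last⇒mid : ∀ R → LastOdd n u R → MiddleOdd n u R
  last⇒mid R (last₆ x) = type₆ x
  last⇒mid R (last₇ x) = type₇ x

  A₁-then-mid : ∀ R → MiddleOdd n u R → ¬ PrefixSuffixMatch (A1o u) R
  A₁-then-mid _ (type₆ (w , dw , _ , refl)) =
    no-match-1heavy A₁-prefix< (ProperSuffix≤-cons true w (Dyck⇒SuffixCond dw))
  A₁-then-mid _ (type₇ (w , dw , _ , refl)) =
    no-match-1heavy A₁-prefix< (SuffixCond⇒ProperSuffix≤ (SuffixCond-snoc0 w (Dyck⇒SuffixCond dw)))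
  A₁-then-mid _ (type₈ (w , dw , refl)) =
    no-match-1heavy A₁-prefix< (ProperSuffix≤-cons false w (Dyck⇒SuffixCond dw))

  mid-then-A₁ : ∀ R → MiddleOdd n u R → ∀ p → MatchOf R (A1o u) p → length p ≡ 1
  mid-then-A₁ _ (type₆ (w , dw , _ , refl)) p match =
    ⊥-elim (no-match-1heavy (Prefix<⇒ProperPrefix< (Prefix<-cons1 w (Dyck⇒PrefixCond dw)))
      A₁-suffix≤ (p , match))
  -- type 7, w0 with w ≠ 1u0, is one shift away from A₁ = 1(1u0)
  mid-then-A₁ _ (type₇ (w , dw , w≢1u0 , refl)) p match =
    ⊥-elim (snoc-cons-no-match false true w (A1e u)
      (trans (Dyck-length dw) (sym (Dyck-length (wrap-Dyck du)))) w≢1u0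
      (PrefixCond⇒ProperPrefix≤ (Dyck⇒PrefixCond dw)) (wrap-ProperSuffix< u scU) (p , match))
  mid-then-A₁ _ (type₈ (w , dw , refl)) =
    zero-row-match w (A1o u) (PrefixCond⇒ProperPrefix≤ (Dyck⇒PrefixCond dw)) A₁-zero-suffix<

  mid-ends-with-0 : ∀ R → MiddleOdd n u R → EndsWith0 R
  mid-ends-with-0 _ (type₆ (w , dw , _ , refl)) with Dyck-ends-with-0 dw
  ... | w' , refl = true ∷ w' , refl
  mid-ends-with-0 _ (type₇ (w , _ , _ , refl)) = w , refl
  mid-ends-with-0 _ (type₈ (w , dw , refl)) with Dyck-ends-with-0 dw
  ... | w' , refl = false ∷ w' , refl

  last-starts-with-1 : ∀ R → LastOdd n u R → StartsWith1 R
  last-starts-with-1 _ (last₆ (w , _ , _ , refl)) = w , refl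
  last-starts-with-1 _ (last₇ (w , dw , _ , refl)) with Dyck-starts-with-1 dw
  ... | w' , refl = w' ++ [0] , refl

-- Even construction.  X differs from A₁ because A₁ = 1u0 is of type 1, and
-- X ends with 0 because no prefix of A₁ is a suffix of X.
even-construction : ∀ (m n : ℕ) (u : BStr) (X : Vec Bool n) (Z : Matrix m n) →
  2 ≤ m → 4 ≤ n → InD (n ∸ 2) u →
  ¬ MiddleEven n u (toList X) →
  NonOverlappingStrings (toList X) (A1e u) →
  IsZ (A1e u) X Z →
  NonOverlappingSet (λ M → InLeven u M ⊎ M ≡ Z)
even-construction (suc m') (suc (suc n')) u X Z (s≤s _) (s≤s (s≤s _)) du not-mid no-overlap isZ =
  L∪Z-non-overlapping (even-row-types n' u du) X Z
    (λ X≡A₁ → not-mid (type₁ (subst (InD _) (sym X≡A₁) (wrap-Dyck du))))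
    no-overlap
    (ends-with-0-or-match (u ++ [0]) (toList X) (snoc≢[] u false)
      (subst (2 ≤_) (sym (length-toList X)) (s≤s (s≤s z≤n))) (proj₂ no-overlap))
    isZ

-- Odd construction.  X differs from A₁ because A₁ = 1(1u0) with 1u0 a Dyck
-- word, and X ends with 0 because no prefix of A₁ is a suffix of X.
odd-construction : ∀ (m n : ℕ) (u : BStr) (X : Vec Bool n) (Z : Matrix m n) →
  2 ≤ m → 5 ≤ n → InD (n ∸ 3) u →
  ¬ OddForm n (toList X) →
  NonOverlappingStrings (toList X) (A1o u) →
  IsZ (A1o u) X Z →
  NonOverlappingSet (λ M → InLodd u M ⊎ M ≡ Z)
odd-construction (suc m') (suc (suc (suc n'))) u X Z (s≤s _) (s≤s (s≤s (s≤s _))) du not-odd no-overlap isZ =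
  L∪Z-non-overlapping (odd-row-types n' u du) X Z
    (λ X≡A₁ → not-odd (A1e u , wrap-Dyck du , inj₁ X≡A₁))
    no-overlap
    (ends-with-0-or-match (A1e u) (toList X) ∷≢[]
      (subst (2 ≤_) (sym (length-toList X)) (s≤s (s≤s z≤n))) (proj₂ no-overlap))
    isZ

-- The parity hypotheses only serve to distinguish the two constructions.
proposition3 : (∀ (m n : ℕ) (u : BStr) (X : Vec Bool n) (Z : Matrix m n) →
    2 ≤ m → 4 ≤ n → 2 ∣ n → InD (n ∸ 2) u →
    ¬ MiddleEven n u (toList X) →
    NonOverlappingStrings (toList X) (A1e u) →
    IsZ (A1e u) X Z →
    NonOverlappingSet (λ M → InLeven u M ⊎ M ≡ Z))
    ×
    (∀ (m n : ℕ) (u : BStr) (X : Vec Bool n) (Z : Matrix m n) →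
    2 ≤ m → 5 ≤ n → ¬ (2 ∣ n) → InD (n ∸ 3) u →
    ¬ OddForm n (toList X) →
    NonOverlappingStrings (toList X) (A1o u) →
    IsZ (A1o u) X Z →
    NonOverlappingSet (λ M → InLodd u M ⊎ M ≡ Z))
proposition3 =
  (λ m n u X Z 2≤m 4≤n _ → even-construction m n u X Z 2≤m 4≤n) ,
  (λ m n u X Z 2≤m 5≤n _ → odd-construction m n u X Z 2≤m 5≤n)
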